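{- Let $G$ be a finite directed multigraph and let $c:\mathcal M_G\to\mathbb R$ be an additive map such that $c(\mathcal C)>-|\mathcal C|$ for every simple directed cycle $\mathcal C$ of $G$. Then $c$ extends to an additive map $c:\mathbb Z^{E(G)}\to\mathbb R$ with $c(e)>-1$ for all $e\in E(G)$.
   Context: $\mathbb Z^{E(G)}$ is the group of formal $\mathbb Z$-linear combinations of edges; a simple directed cycle is identified with the formal sum of its edges; $\mathcal M_G$ is the subgroup generated by simple directed cycles. $|\mathcal C|$ is the number of edges of $\mathcal C$. -}

module Defs where

open import Level using (Level; _⊔_) renaming (suc to lsuc)
open import Algebra.Bundles using (CommutativeRing)
open import Data.Nat as ℕ using (ℕ)
open import Data.Integer as ℤ using (ℤ; +_; -[1+_])
open import Data.Fin using (Fin; zero; suc)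
import Data.Fin
open import Data.Fin.Properties using (_≟_)
open import Data.Sum using (_⊎_)
open import Data.Product using (∃; Σ; _×_; ∃-syntax)
open import Relation.Nullary using (¬_; yes; no)
open import Relation.Binary.PropositionalEquality using (_≡_)
open import Function.Definitions using (Injective)

-- The real numbers, axiomatised as a (Dedekind-)complete ordered field.
-- Any two models are isomorphic, so quantifying over all models is the
-- same as speaking about ℝ.

record RealField (c ℓ : Level) : Set (lsuc (c ⊔ ℓ)) where
  field
    commRing : CommutativeRing c ℓ
  open CommutativeRing commRing public
  field
    _<_        : Carrier → Carrier → Set ℓ
    <-irrefl   : ∀ {x y} → x ≈ y → ¬ (x < y)
    <-trans    : ∀ {x y z} → x < y → y < z → x < z
    <-respˡ-≈  : ∀ {x y z} → x ≈ y → x < z → y < z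
    <-respʳ-≈  : ∀ {x y z} → x ≈ y → z < x → z < y
    <-trichotomy : ∀ x y → x < y ⊎ x ≈ y ⊎ y < x
    +-monoˡ-<  : ∀ {x y} z → x < y → (x + z) < (y + z)
    *-pos      : ∀ {x y} → 0# < x → 0# < y → 0# < (x * y)
    0<1        : 0# < 1#
    inverse    : ∀ x → ¬ (x ≈ 0#) → ∃[ y ] (x * y ≈ 1#)
  _≤_ : Carrier → Carrier → Set ℓ
  x ≤ y = x < y ⊎ x ≈ y
  field
    sup : (P : Carrier → Set ℓ) → ∃[ x ] P x → ∃[ b ] (∀ x → P x → x ≤ b) →
          ∃[ s ] ((∀ x → P x → x ≤ s) × (∀ b → (∀ x → P x → x ≤ b) → s ≤ b))

  fromℕ : ℕ → Carrier
  fromℕ ℕ.zero    = 0#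
  fromℕ (ℕ.suc n) = 1# + fromℕ n

  fromℤ : ℤ → Carrier
  fromℤ (+ n)      = fromℕ n
  fromℤ -[1+ n ]   = - fromℕ (ℕ.suc n)

record Digraph : Set where
  field
    nV  : ℕ
    nE  : ℕ
    src : Fin nE → Fin nV
    tgt : Fin nE → Fin nV

module _ (G : Digraph) where
  open Digraph G

  ZE : Set
  ZE = Fin nE → ℤ

  _≐_ : ZE → ZE → Set
  x ≐ y = ∀ e → x e ≡ y e

  _⊕_ : ZE → ZE → ZE
  (x ⊕ y) e = x e ℤ.+ y e

  ⊖_ : ZE → ZE
  (⊖ x) e = ℤ.- x e

  𝟘 : ZE
  𝟘 _ = + 0

  δ : Fin nE → ZE
  δ e e' with e ≟ e'
  ... | yes _ = + 1
  ... | no  _ = + 0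

  -- A simple directed cycle of length suc k: edges cyc 0, …, cyc k with
  -- tgt (cyc i) = src (cyc (i+1)) cyclically and pairwise distinct
  -- source vertices (hence distinct vertices and distinct edges).
  record SimpleCycle : Set where
    field
      k      : ℕ
      cyc    : Fin (ℕ.suc k) → Fin nE
      chain  : ∀ (i : Fin k) → tgt (cyc (Data.Fin.inject₁ i)) ≡ src (cyc (suc i))
      close  : tgt (cyc (Data.Fin.fromℕ k)) ≡ src (cyc zero)
      simple : Injective _≡_ _≡_ (λ i → src (cyc i))

  len : SimpleCycle → ℕ
  len C = ℕ.suc (SimpleCycle.k C)

  sumFin : ∀ {j} → (Fin j → ZE) → ZE
  sumFin {ℕ.zero}  f = 𝟘
  sumFin {ℕ.suc j} f = f zero ⊕ sumFin (λ i → f (suc i))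

  -- a simple directed cycle identified with the formal sum of its edges
  ⟦_⟧ : SimpleCycle → ZE
  ⟦ C ⟧ = sumFin (λ i → δ (SimpleCycle.cyc C i))

  -- M_G: the subgroup of ℤ^{E(G)} generated by the simple directed cycles
  data InM : ZE → Set where
    gen  : (C : SimpleCycle) → InM ⟦ C ⟧
    zer  : InM 𝟘
    add  : ∀ {x y} → InM x → InM y → InM (x ⊕ y)
    neg  : ∀ {x} → InM x → InM (⊖ x)
    resp : ∀ {x y} → x ≐ y → InM x → InM y

  module _ {c ℓ} (R : RealField c ℓ) where
    open RealField R

    -- additive maps M_G → ℝ (well defined on elements, independent of
    -- the membership witness)
    record AdditiveOnM : Set (c ⊔ ℓ) where
      field
        fun      : (x : ZE) → InM x → Carrier
        wd       : ∀ {x y} (p : InM x) (q : InM y) → x ≐ y → fun x p ≈ fun y q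
        additive : ∀ {x y} (p : InM x) (q : InM y) (r : InM (x ⊕ y)) →
                   fun (x ⊕ y) r ≈ (fun x p + fun y q)

    record Additive : Set (c ⊔ ℓ) where
      field
        fun      : ZE → Carrier
        wd       : ∀ {x y} → x ≐ y → fun x ≈ fun y
        additive : ∀ x y → fun (x ⊕ y) ≈ (fun x + fun y)

module Submission where

-- Adding the edge count N(x) = Σₑ xₑ reduces this to the positive case: an
-- additive a on M that is positive on simple cycles extends to ℤ^E with
-- positive edge values (then subtract N again).  For the positive case:
--  * a closed walk splits into simple cycles, so its edge vector lies in M
--    and has positive a-value;
--  * fixing a root in each strongly connected component (reachability is
--    decidable) and routing each edge through it gives weights h₀ whose sum
--    along any closed walk is its a-value;
--  * so every cycle has positive h₀-weight, and Fourier–Motzkin elimination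
--    gives a potential p making h = h₀ + p(src) - p(tgt) positive, with the
--    same sums along closed walks;
--  * the linear map with edge values h agrees with a on simple cycles, hence
--    on all of M.

open import Defs
open import Level using (Level; _⊔_)
open import Data.Nat as ℕ using (ℕ; z≤n; s≤s)
import Data.Nat.Properties as ℕP
open import Data.Integer as ℤ using (+_; -[1+_])
import Data.Integer.Properties as ℤP
open import Data.Fin using (Fin; zero; suc)
import Data.Fin as Fin
open import Data.Fin.Properties using (_≟_; any?; injective⇒≤; suc-injective)
open import Data.Vec.Functional using (Vector)
open import Data.Sum using (_⊎_; inj₁; inj₂)
open import Data.Product using (Σ; _×_; _,_; proj₁; proj₂; ∃; ∃-syntax)
open import Data.List using (List; []; _∷_)
open import Data.List.Membership.Propositional using (_∈_; _∉_)
open import Data.List.Relation.Unary.Any using (here; there) renaming (any? to any∈?)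
open import Data.Unit using (⊤; tt)
open import Data.Empty using (⊥-elim)
open import Relation.Nullary using (¬_; yes; no)
open import Relation.Binary.PropositionalEquality as ≡ using (_≡_; _≢_)

module OrderedField {c ℓ} (R : RealField c ℓ) where
  open RealField R hiding (zero; _<_; _≤_)
  open import Algebra.Properties.Ring ring
    using (-0#≈0#; -‿+-comm; //-rightDividesˡ; -‿distribˡ-*)
  open import Algebra.Properties.CommutativeSemigroup +-commutativeSemigroup
    using () renaming (interchange to +-interchange)
  open import Algebra.Properties.Semiring.Sum semiring
    using (sum; sum-cong-≋; sum-replicate-zero)
  open import Relation.Binary.Reasoning.Setoid setoid

  infix 4 _<_
  _<_ : Carrier → Carrier → Set ℓ
  _<_ = RealField._<_ R

  <-resp₂ : ∀ {x x′ y y′} → x ≈ x′ → y ≈ y′ → x < y → x′ < y′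
  <-resp₂ x≈x′ y≈y′ x<y = <-respʳ-≈ y≈y′ (<-respˡ-≈ x≈x′ x<y)

  +-monoʳ-< : ∀ {x y} z → x < y → z + x < z + y
  +-monoʳ-< {x} {y} z x<y = <-resp₂ (+-comm x z) (+-comm y z) (+-monoˡ-< z x<y)

  <⇒0<-diff : ∀ {a b} → a < b → 0# < b + - a
  <⇒0<-diff {a} a<b = <-respˡ-≈ (-‿inverseʳ a) (+-monoˡ-< (- a) a<b)

  0<-diff⇒< : ∀ {a b} → 0# < b + - a → a < b
  0<-diff⇒< {a} {b} 0<b-a =
    <-resp₂ (+-identityˡ a) (//-rightDividesˡ a b) (+-monoˡ-< a 0<b-a)

  +-pos : ∀ {a b} → 0# < a → 0# < b → 0# < a + b
  +-pos {a} {b} 0<a 0<b = <-trans 0<b (<-respˡ-≈ (+-identityˡ b) (+-monoˡ-< b 0<a))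

  neg-<0 : ∀ {a} → 0# < a → - a < 0#
  neg-<0 {a} 0<a = <-resp₂ (+-identityˡ (- a)) (-‿inverseʳ a) (+-monoˡ-< (- a) 0<a)

  *-monoʳ-< : ∀ {z x y} → 0# < z → x < y → x * z < y * z
  *-monoʳ-< {z} {x} {y} 0<z x<y = 0<-diff⇒< (<-respʳ-≈ expand (*-pos (<⇒0<-diff x<y) 0<z))
    where
    expand : (y + - x) * z ≈ y * z + - (x * z)
    expand = begin
      (y + - x) * z     ≈⟨ distribʳ z y (- x) ⟩
      y * z + - x * z   ≈⟨ +-congˡ (sym (-‿distribˡ-* x z)) ⟩
      y * z + - (x * z) ∎

  dense : ∀ {a b} → a < b → ∃[ x ] (a < x × x < b)
  dense {a} {b} a<b = (a + b) * h , a<mid , mid<b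
    where
    0<2 : 0# < 1# + 1#
    0<2 = +-pos 0<1 0<1

    half : ∃[ y ] ((1# + 1#) * y ≈ 1#)
    half = inverse (1# + 1#) (λ 2≈0 → <-irrefl (sym 2≈0) 0<2)

    h : Carrier
    h = proj₁ half

    halves : ∀ x → x * h + x * h ≈ x
    halves x = begin
      x * h + x * h         ≈⟨ sym (distribˡ x h h) ⟩
      x * (h + h)           ≈⟨ *-congˡ (+-cong (sym (*-identityˡ h)) (sym (*-identityˡ h))) ⟩
      x * (1# * h + 1# * h) ≈⟨ *-congˡ (sym (distribʳ h 1# 1#)) ⟩
      x * ((1# + 1#) * h)   ≈⟨ *-congˡ (proj₂ half) ⟩
      x * 1#                ≈⟨ *-identityʳ x ⟩
      x                     ∎

    -- h is positive: h ≈ 0 gives 1 ≈ 0 and h < 0 gives 2h < 0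
    0<h : 0# < h
    0<h with <-trichotomy 0# h
    ... | inj₁ 0<h = 0<h
    ... | inj₂ (inj₁ 0≈h) = ⊥-elim (<-irrefl (sym 1≈0) 0<1)
      where
      1≈0 : 1# ≈ 0#
      1≈0 = begin
        1#               ≈⟨ sym (proj₂ half) ⟩
        (1# + 1#) * h    ≈⟨ *-congˡ (sym 0≈h) ⟩
        (1# + 1#) * 0#   ≈⟨ zeroʳ _ ⟩
        0#               ∎
    ... | inj₂ (inj₂ h<0) =
      ⊥-elim (<-irrefl refl (<-trans 1<0 0<1))
      where
      1<0 : 1# < 0#
      1<0 = <-resp₂ (trans (*-comm h _) (proj₂ half)) (zeroˡ _) (*-monoʳ-< 0<2 h<0)

    a<mid : a < (a + b) * h
    a<mid = <-resp₂ (halves a) (sym (distribʳ h a b)) (+-monoʳ-< (a * h) (*-monoʳ-< 0<h a<b))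

    mid<b : (a + b) * h < b
    mid<b = <-resp₂ (sym (distribʳ h a b)) (halves b) (+-monoˡ-< (b * h) (*-monoʳ-< 0<h a<b))

  -- u ≤ x, in the form produced by trichotomy, and x < v give u < v
  ≤-<-trans : ∀ {x u v} → x ≈ u ⊎ u < x → x < v → u < v
  ≤-<-trans (inj₁ x≈u) x<v = <-respˡ-≈ x≈u x<v
  ≤-<-trans (inj₂ u<x) x<v = <-trans u<x x<v

  -- Separation of finite sets: if every element of L lies below every element
  -- of U, some x lies strictly between them.  This is the step that lets
  -- Fourier–Motzkin elimination choose the potential of the eliminated vertex.
  lowerBound : ∀ (U : List Carrier) → ∃[ x ] (∀ {u} → u ∈ U → x < u)
  lowerBound [] = 0# , λ ()
  lowerBound (u ∷ U) with lowerBound U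
  ... | x , x<U with <-trichotomy x u
  ... | inj₁ x<u = x , λ { (here ≡.refl) → x<u ; (there m) → x<U m }
  ... | inj₂ u≤x =
          u + - 1# , λ { (here ≡.refl) → u-1<u ; (there m) → <-trans u-1<u (≤-<-trans u≤x (x<U m)) }
    where
    u-1<u : u + - 1# < u
    u-1<u = <-respʳ-≈ (+-identityʳ u) (+-monoʳ-< u (neg-<0 0<1))

  between : ∀ a (U : List Carrier) → (∀ {u} → u ∈ U → a < u) →
            ∃[ x ] (a < x × (∀ {u} → u ∈ U → x < u))
  between a [] _ = a + 1# , <-respˡ-≈ (+-identityʳ a) (+-monoʳ-< a 0<1) , λ ()
  between a (u ∷ U) a<U with between a U (λ m → a<U (there m))
  ... | x , a<x , x<U with <-trichotomy x u
  ... | inj₁ x<u = x , a<x , λ { (here ≡.refl) → x<u ; (there m) → x<U m }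
  ... | inj₂ u≤x with dense (a<U (here ≡.refl))
  ...   | y , a<y , y<u =
          y , a<y , λ { (here ≡.refl) → y<u ; (there m) → <-trans y<u (≤-<-trans u≤x (x<U m)) }

  separate : ∀ (L U : List Carrier) → (∀ {l u} → l ∈ L → u ∈ U → l < u) →
             ∃[ x ] ((∀ {l} → l ∈ L → l < x) × (∀ {u} → u ∈ U → x < u))
  separate [] U _ = proj₁ (lowerBound U) , (λ ()) , proj₂ (lowerBound U)
  separate (l ∷ L) U L<U with separate L U (λ m n → L<U (there m) n)
  ... | x , L<x , x<U with <-trichotomy l x
  ... | inj₁ l<x = x , (λ { (here ≡.refl) → l<x ; (there m) → L<x m }) , x<U
  ... | inj₂ x≤l with between l U (λ n → L<U (here ≡.refl) n)
  ...   | y , l<y , y<U =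
          y , (λ { (here ≡.refl) → l<y ; (there m) → <-trans (L<x m) (≤-<-trans x≤l l<y) }) , y<U

  fromℕ-+ : ∀ m n → fromℕ (m ℕ.+ n) ≈ fromℕ m + fromℕ n
  fromℕ-+ ℕ.zero n = sym (+-identityˡ (fromℕ n))
  fromℕ-+ (ℕ.suc m) n = trans (+-congˡ (fromℕ-+ m n)) (sym (+-assoc 1# (fromℕ m) (fromℕ n)))

  shift-diff : ∀ z x y → (z + x) + - (z + y) ≈ x + - y
  shift-diff z x y = begin
    (z + x) + - (z + y)   ≈⟨ +-congˡ (sym (-‿+-comm z y)) ⟩
    (z + x) + (- z + - y) ≈⟨ +-interchange z x (- z) (- y) ⟩
    (z + - z) + (x + - y) ≈⟨ +-congʳ (-‿inverseʳ z) ⟩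
    0# + (x + - y)        ≈⟨ +-identityˡ _ ⟩
    x + - y               ∎

  fromℤ-⊖ : ∀ m n → fromℤ (m ℤ.⊖ n) ≈ fromℕ m + - fromℕ n
  fromℤ-⊖ ℕ.zero ℕ.zero = sym (-‿inverseʳ 0#)
  fromℤ-⊖ ℕ.zero (ℕ.suc n) = sym (+-identityˡ _)
  fromℤ-⊖ (ℕ.suc m) ℕ.zero = sym (trans (+-congˡ -0#≈0#) (+-identityʳ _))
  fromℤ-⊖ (ℕ.suc m) (ℕ.suc n) = begin
    fromℤ (ℕ.suc m ℤ.⊖ ℕ.suc n)         ≡⟨ ≡.cong fromℤ (ℤP.[1+m]⊖[1+n]≡m⊖n m n) ⟩
    fromℤ (m ℤ.⊖ n)                     ≈⟨ fromℤ-⊖ m n ⟩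
    fromℕ m + - fromℕ n                 ≈⟨ shift-diff 1# (fromℕ m) (fromℕ n) ⟨
    fromℕ (ℕ.suc m) + - fromℕ (ℕ.suc n) ∎

  fromℤ-+ : ∀ a b → fromℤ (a ℤ.+ b) ≈ fromℤ a + fromℤ b
  fromℤ-+ (+ m) (+ n) = fromℕ-+ m n
  fromℤ-+ (+ m) -[1+ n ] = fromℤ-⊖ m (ℕ.suc n)
  fromℤ-+ -[1+ m ] (+ n) = trans (fromℤ-⊖ n (ℕ.suc m)) (+-comm _ _)
  fromℤ-+ -[1+ m ] -[1+ n ] = begin
    - fromℕ (ℕ.suc (ℕ.suc (m ℕ.+ n)))     ≡⟨ ≡.cong (λ k → - fromℕ (ℕ.suc k)) (ℕP.+-suc m n) ⟨
    - fromℕ (ℕ.suc m ℕ.+ ℕ.suc n)         ≈⟨ -‿cong (fromℕ-+ (ℕ.suc m) (ℕ.suc n)) ⟩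
    - (fromℕ (ℕ.suc m) + fromℕ (ℕ.suc n)) ≈⟨ -‿+-comm _ _ ⟨
    - fromℕ (ℕ.suc m) + - fromℕ (ℕ.suc n) ∎

  sum-zero : ∀ {m} (f : Vector Carrier m) → (∀ i → f i ≈ 0#) → sum f ≈ 0#
  sum-zero {m} f f≈0 = trans (sum-cong-≋ f≈0) (sum-replicate-zero m)

  sum-single : ∀ {m} (f : Vector Carrier m) (e : Fin m) → (∀ i → e ≢ i → f i ≈ 0#) → sum f ≈ f e
  sum-single f zero off =
    trans (+-congˡ (sum-zero (λ i → f (suc i)) (λ i → off (suc i) (λ ())))) (+-identityʳ (f zero))
  sum-single f (suc e) off =
    trans (+-cong (off zero (λ ())) (sum-single (λ i → f (suc i)) e off′)) (+-identityˡ (f (suc e)))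
    where
    off′ : ∀ i → e ≢ i → f (suc i) ≈ 0#
    off′ i e≢i = off (suc i) (λ eq → e≢i (suc-injective eq))

  sum-ones : ∀ n → sum {n} (λ _ → 1#) ≈ fromℕ n
  sum-ones ℕ.zero = refl
  sum-ones (ℕ.suc n) = +-congˡ (sum-ones n)

module Potentials {c ℓ} (R : RealField c ℓ) where
  open RealField R hiding (zero; _<_; _≤_)
  open OrderedField R
  open import Algebra.Properties.Ring ring using (-‿+-comm; -‿involutive; //-rightDividesʳ)
  open import Algebra.Solver.CommutativeMonoid +-commutativeMonoid
    using (solve; _⊜_) renaming (_⊕_ to _⊞_)
  open import Data.List using (_++_; map; cartesianProduct)
  open import Data.List.Membership.Propositional.Properties
    using (∈-map⁺; ∈-map⁻; ∈-++⁺ˡ; ∈-++⁺ʳ; ∈-++⁻; ∈-cartesianProduct⁺; ∈-cartesianProductWith⁻)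
  open import Relation.Binary.Reasoning.Setoid setoid

  -- a weighted edge: source, target, weight
  Edge : ℕ → Set c
  Edge n = Fin n × Fin n × Carrier

  data Walk {n} (es : List (Edge n)) : Fin n → Fin n → Set c where
    []   : ∀ {u} → Walk es u u
    step : ∀ {s t w v} → (s , t , w) ∈ es → Walk es t v → Walk es s v

  weight : ∀ {n} {es : List (Edge n)} {u v} → Walk es u v → Carrier
  weight [] = 0#
  weight (step {w = w} _ r) = w + weight r

  infixr 5 _++ʷ_
  _++ʷ_ : ∀ {n} {es : List (Edge n)} {u v x} → Walk es u v → Walk es v x → Walk es u x
  [] ++ʷ q = q
  step m r ++ʷ q = step m (r ++ʷ q)

  weight-++ : ∀ {n} {es : List (Edge n)} {u v x} (p : Walk es u v) (q : Walk es v x) →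
              weight (p ++ʷ q) ≈ weight p + weight q
  weight-++ [] q = sym (+-identityˡ (weight q))
  weight-++ (step {w = w} m r) q =
    trans (+-congˡ (weight-++ r q)) (sym (+-assoc w (weight r) (weight q)))

  -- every cycle, written as an edge followed by a walk back, has positive weight
  PositiveCycles : ∀ {n} → List (Edge n) → Set (c ⊔ ℓ)
  PositiveCycles es = ∀ {s t w} → (s , t , w) ∈ es → (r : Walk es t s) → 0# < w + weight r

  Feasible : ∀ {n} → List (Edge n) → (Fin n → Carrier) → Set (c ⊔ ℓ)
  Feasible es p = ∀ {s t w} → (s , t , w) ∈ es → 0# < (w + p s) + - p t

  -- Eliminating vertex zero: keep the edges avoiding it, and replace each pair
  -- of an edge u → 0 (weight a) and an edge 0 → v (weight b) by u → v (a + b).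
  avoiding : ∀ {n} → List (Edge (ℕ.suc n)) → List (Edge n)
  avoiding [] = []
  avoiding ((suc s , suc t , w) ∷ es) = (s , t , w) ∷ avoiding es
  avoiding ((zero , t , w) ∷ es) = avoiding es
  avoiding ((suc s , zero , w) ∷ es) = avoiding es

  into₀ : ∀ {n} → List (Edge (ℕ.suc n)) → List (Fin n × Carrier)
  into₀ [] = []
  into₀ ((suc s , zero , w) ∷ es) = (s , w) ∷ into₀ es
  into₀ ((suc s , suc t , w) ∷ es) = into₀ es
  into₀ ((zero , t , w) ∷ es) = into₀ es

  outOf₀ : ∀ {n} → List (Edge (ℕ.suc n)) → List (Fin n × Carrier)
  outOf₀ [] = []
  outOf₀ ((zero , suc t , w) ∷ es) = (t , w) ∷ outOf₀ es
  outOf₀ ((zero , zero , w) ∷ es) = outOf₀ es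
  outOf₀ ((suc s , t , w) ∷ es) = outOf₀ es

  splice : ∀ {n} → (Fin n × Carrier) × (Fin n × Carrier) → Edge n
  splice ((u , a) , (v , b)) = (u , v , a + b)

  eliminate : ∀ {n} → List (Edge (ℕ.suc n)) → List (Edge n)
  eliminate es = avoiding es ++ map splice (cartesianProduct (into₀ es) (outOf₀ es))

  avoiding⁻ : ∀ {n} (es : List (Edge (ℕ.suc n))) {s t w} →
              (s , t , w) ∈ avoiding es → (suc s , suc t , w) ∈ es
  avoiding⁻ ((suc s , suc t , w) ∷ es) (here ≡.refl) = here ≡.refl
  avoiding⁻ ((suc s , suc t , w) ∷ es) (there m) = there (avoiding⁻ es m)
  avoiding⁻ ((zero , t , w) ∷ es) m = there (avoiding⁻ es m)
  avoiding⁻ ((suc s , zero , w) ∷ es) m = there (avoiding⁻ es m)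

  avoiding⁺ : ∀ {n} (es : List (Edge (ℕ.suc n))) {s t w} →
              (suc s , suc t , w) ∈ es → (s , t , w) ∈ avoiding es
  avoiding⁺ ((suc s , suc t , w) ∷ es) (here ≡.refl) = here ≡.refl
  avoiding⁺ ((suc s , suc t , w) ∷ es) (there m) = there (avoiding⁺ es m)
  avoiding⁺ ((zero , t , w) ∷ es) (there m) = avoiding⁺ es m
  avoiding⁺ ((suc s , zero , w) ∷ es) (there m) = avoiding⁺ es m

  into₀⁻ : ∀ {n} (es : List (Edge (ℕ.suc n))) {s w} → (s , w) ∈ into₀ es → (suc s , zero , w) ∈ es
  into₀⁻ ((suc s , zero , w) ∷ es) (here ≡.refl) = here ≡.refl
  into₀⁻ ((suc s , zero , w) ∷ es) (there m) = there (into₀⁻ es m)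
  into₀⁻ ((suc s , suc t , w) ∷ es) m = there (into₀⁻ es m)
  into₀⁻ ((zero , t , w) ∷ es) m = there (into₀⁻ es m)

  into₀⁺ : ∀ {n} (es : List (Edge (ℕ.suc n))) {s w} → (suc s , zero , w) ∈ es → (s , w) ∈ into₀ es
  into₀⁺ ((suc s , zero , w) ∷ es) (here ≡.refl) = here ≡.refl
  into₀⁺ ((suc s , zero , w) ∷ es) (there m) = there (into₀⁺ es m)
  into₀⁺ ((suc s , suc t , w) ∷ es) (there m) = into₀⁺ es m
  into₀⁺ ((zero , t , w) ∷ es) (there m) = into₀⁺ es m

  outOf₀⁻ : ∀ {n} (es : List (Edge (ℕ.suc n))) {t w} → (t , w) ∈ outOf₀ es → (zero , suc t , w) ∈ es
  outOf₀⁻ ((zero , suc t , w) ∷ es) (here ≡.refl) = here ≡.refl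
  outOf₀⁻ ((zero , suc t , w) ∷ es) (there m) = there (outOf₀⁻ es m)
  outOf₀⁻ ((zero , zero , w) ∷ es) m = there (outOf₀⁻ es m)
  outOf₀⁻ ((suc s , t , w) ∷ es) m = there (outOf₀⁻ es m)

  outOf₀⁺ : ∀ {n} (es : List (Edge (ℕ.suc n))) {t w} → (zero , suc t , w) ∈ es → (t , w) ∈ outOf₀ es
  outOf₀⁺ ((zero , suc t , w) ∷ es) (here ≡.refl) = here ≡.refl
  outOf₀⁺ ((zero , suc t , w) ∷ es) (there m) = there (outOf₀⁺ es m)
  outOf₀⁺ ((zero , zero , w) ∷ es) (there m) = outOf₀⁺ es m
  outOf₀⁺ ((suc s , t , w) ∷ es) (there m) = outOf₀⁺ es m

  -- An edge of the eliminated graph is a nonempty walk of the same weight in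
  -- the original graph (one edge, or two edges through vertex zero).
  record Expansion {n} (es : List (Edge (ℕ.suc n))) (s t : Fin (ℕ.suc n)) (w : Carrier) : Set (c ⊔ ℓ) where
    constructor expansion
    field
      {mid}    : Fin (ℕ.suc n)
      {first}  : Carrier
      first∈   : (s , mid , first) ∈ es
      rest     : Walk es mid t
      weight≈  : first + weight rest ≈ w

  expandEdge : ∀ {n} (es : List (Edge (ℕ.suc n))) {s t w} →
               (s , t , w) ∈ eliminate es → Expansion es (suc s) (suc t) w
  expandEdge es m with ∈-++⁻ (avoiding es) m
  ... | inj₁ m′ = expansion (avoiding⁻ es m′) [] (+-identityʳ _)
  ... | inj₂ m′ with ∈-map⁻ splice m′
  ... | _ , m″ , ≡.refl with ∈-cartesianProductWith⁻ _,_ (into₀ es) (outOf₀ es) m″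
  ... | (_ , a) , (_ , b) , ∈in , ∈out , ≡.refl =
        expansion (into₀⁻ es ∈in) (step (outOf₀⁻ es ∈out) []) (+-congˡ (+-identityʳ b))

  expand-then : ∀ {n} {es : List (Edge (ℕ.suc n))} {s t w v} →
                Expansion es s t w → Walk es t v → Walk es s v
  expand-then x q = step (Expansion.first∈ x) (Expansion.rest x ++ʷ q)

  weight-expand-then : ∀ {n} {es : List (Edge (ℕ.suc n))} {s t w v}
                       (x : Expansion es s t w) (q : Walk es t v) →
                       weight (expand-then x q) ≈ w + weight q
  weight-expand-then (expansion {first = a} _ rest eq) q = begin
    a + weight (rest ++ʷ q)      ≈⟨ +-congˡ (weight-++ rest q) ⟩
    a + (weight rest + weight q) ≈⟨ +-assoc _ _ _ ⟨
    (a + weight rest) + weight q ≈⟨ +-congʳ eq ⟩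
    _ + weight q                 ∎

  expandWalk : ∀ {n} (es : List (Edge (ℕ.suc n))) {u v} (r : Walk (eliminate es) u v) →
               Σ (Walk es (suc u) (suc v)) λ q → weight q ≈ weight r
  expandWalk es [] = [] , refl
  expandWalk es (step m r) with expandWalk es r
  ... | q , q≈r = expand-then (expandEdge es m) q ,
                  trans (weight-expand-then (expandEdge es m) q) (+-congˡ q≈r)

  eliminate-positive : ∀ {n} (es : List (Edge (ℕ.suc n))) →
                       PositiveCycles es → PositiveCycles (eliminate es)
  eliminate-positive es pos m r with expandWalk es r
  ... | q , q≈r = <-respʳ-≈ (trans (weight-expand-then x q) (+-congˡ q≈r)) (pos (Expansion.first∈ x) (Expansion.rest x ++ʷ q))
    where x = expandEdge es m

  neg-diff : ∀ a b → - (a + - b) ≈ - a + b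
  neg-diff a b = trans (sym (-‿+-comm a (- b))) (+-congˡ (-‿involutive b))

  -- Given potentials p′ of the other vertices, an edge 0 → v of weight b forces
  -- p(0) > p′(v) - b and an edge u → 0 of weight a forces p(0) < p′(u) + a.
  floor₀ : ∀ {n} → (Fin n → Carrier) → Fin n × Carrier → Carrier
  floor₀ p′ (v , b) = p′ v + - b

  ceiling₀ : ∀ {n} → (Fin n → Carrier) → Fin n × Carrier → Carrier
  ceiling₀ p′ (u , a) = p′ u + a

  floors<ceilings : ∀ {n} (es : List (Edge (ℕ.suc n))) (p′ : Fin n → Carrier) →
                    Feasible (eliminate es) p′ → ∀ {l u} →
                    l ∈ map (floor₀ p′) (outOf₀ es) → u ∈ map (ceiling₀ p′) (into₀ es) → l < u
  floors<ceilings es p′ feasible′ l∈ u∈ with ∈-map⁻ (floor₀ p′) l∈ | ∈-map⁻ (ceiling₀ p′) u∈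
  ... | (v , b) , ∈out , ≡.refl | (u , a) , ∈in , ≡.refl =
    0<-diff⇒< (<-respʳ-≈ rearrange
      (feasible′ (∈-++⁺ʳ (avoiding es) (∈-map⁺ splice (∈-cartesianProduct⁺ ∈in ∈out)))))
    where
    rearrange : ((a + b) + p′ u) + - p′ v ≈ (p′ u + a) + - (p′ v + - b)
    rearrange = begin
      ((a + b) + p′ u) + - p′ v ≈⟨ solve 4 (λ a b p q → (((a ⊞ b) ⊞ p) ⊞ q) ⊜ ((p ⊞ a) ⊞ (q ⊞ b)))
                                          refl a b (p′ u) (- p′ v) ⟩
      (p′ u + a) + (- p′ v + b)   ≈⟨ +-congˡ (neg-diff (p′ v) b) ⟨
      (p′ u + a) + - (p′ v + - b) ∎

  potential : ∀ n (es : List (Edge n)) → PositiveCycles es → Σ (Fin n → Carrier) (Feasible es)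
  potential ℕ.zero es _ = (λ ()) , λ { {()} _ }
  potential (ℕ.suc n) es pos with potential n (eliminate es) (eliminate-positive es pos)
  ... | p′ , feasible′
      with separate (map (floor₀ p′) (outOf₀ es)) (map (ceiling₀ p′) (into₀ es))
                    (floors<ceilings es p′ feasible′)
  ... | x , floors<x , x<ceilings = p , feasible
    where
    p : Fin (ℕ.suc n) → Carrier
    p zero = x
    p (suc i) = p′ i

    feasible : Feasible es p
    feasible {zero} {zero} {w} m =
      <-respʳ-≈ (trans (+-identityʳ w) (sym (//-rightDividesʳ x w))) (pos m [])
    feasible {suc s} {suc t} m = feasible′ (∈-++⁺ˡ (avoiding⁺ es m))
    feasible {suc u} {zero} {w} m =
      <-respʳ-≈ (+-congʳ (+-comm (p′ u) w))
        (<⇒0<-diff (x<ceilings (∈-map⁺ (ceiling₀ p′) (into₀⁺ es m))))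
    feasible {zero} {suc v} {w} m =
      <-respʳ-≈ rearrange (<⇒0<-diff (floors<x (∈-map⁺ (floor₀ p′) (outOf₀⁺ es m))))
      where
      rearrange : x + - (p′ v + - w) ≈ (w + x) + - p′ v
      rearrange = begin
        x + - (p′ v + - w) ≈⟨ +-congˡ (neg-diff (p′ v) w) ⟩
        x + (- p′ v + w)   ≈⟨ solve 3 (λ x q w → (x ⊞ (q ⊞ w)) ⊜ ((w ⊞ x) ⊞ q)) refl x (- p′ v) w ⟩
        (w + x) + - p′ v   ∎

module Walks (G : Digraph) where
  open Digraph G
  open ≡ using (refl; sym; trans; cong; cong₂; subst; subst₂)
  open import Data.List using (length; lookup)

  infixl 6 _+ᴱ_
  _+ᴱ_ : ZE G → ZE G → ZE G
  _+ᴱ_ = _⊕_ G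

  data Walk : Fin nV → Fin nV → Set where
    []   : ∀ {u} → Walk u u
    step : ∀ {u t v} (e : Fin nE) → src e ≡ u → tgt e ≡ t → Walk t v → Walk u v

  edges : ∀ {u v} → Walk u v → List (Fin nE)
  edges [] = []
  edges (step e _ _ r) = e ∷ edges r

  ∣_∣ : ∀ {u v} → Walk u v → ℕ
  ∣ w ∣ = length (edges w)

  vec : ∀ {u v} → Walk u v → ZE G
  vec [] = 𝟘 G
  vec (step e _ _ r) = δ G e +ᴱ vec r

  sources : ∀ {u v} → Walk u v → List (Fin nV)
  sources [] = []
  sources (step {u} e _ _ r) = u ∷ sources r

  infixr 5 _++ʷ_
  _++ʷ_ : ∀ {u v x} → Walk u v → Walk v x → Walk u x
  [] ++ʷ q = q
  step e s t r ++ʷ q = step e s t (r ++ʷ q)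

  vec-++ : ∀ {u v x} (p : Walk u v) (q : Walk v x) → ∀ i → vec (p ++ʷ q) i ≡ (vec p +ᴱ vec q) i
  vec-++ [] q i = sym (ℤP.+-identityˡ (vec q i))
  vec-++ (step e _ _ r) q i =
    trans (cong (λ z → δ G e i ℤ.+ z) (vec-++ r q i)) (sym (ℤP.+-assoc (δ G e i) (vec r i) (vec q i)))

  ∣∣-++ : ∀ {u v x} (p : Walk u v) (q : Walk v x) → ∣ p ++ʷ q ∣ ≡ ∣ p ∣ ℕ.+ ∣ q ∣
  ∣∣-++ [] q = refl
  ∣∣-++ (step e _ _ r) q = cong ℕ.suc (∣∣-++ r q)

  Distinct : List (Fin nV) → Set
  Distinct [] = ⊤
  Distinct (x ∷ xs) = x ∉ xs × Distinct xs

  record Through {t y} (x : Fin nV) (r : Walk t y) : Set where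
    field
      before          : Walk t x
      after           : Walk x y
      after-nonempty  : 0 ℕ.< ∣ after ∣
      vec≡            : ∀ i → vec r i ≡ (vec before +ᴱ vec after) i
      length≡         : ∣ r ∣ ≡ ∣ before ∣ ℕ.+ ∣ after ∣
      distinct-after  : Distinct (sources r) → Distinct (sources after)

  through : ∀ {x t y} (r : Walk t y) → x ∈ sources r → Through x r
  through (step e s t r) (here refl) = record
    { before = [] ; after = step e s t r ; after-nonempty = s≤s z≤n
    ; vec≡ = λ i → sym (ℤP.+-identityˡ _) ; length≡ = refl ; distinct-after = λ d → d }
  through (step e s t r) (there x∈) = record
    { before = step e s t (Through.before r′) ; after = Through.after r′
    ; after-nonempty = Through.after-nonempty r′
    ; vec≡ = λ i → trans (cong (λ z → δ G e i ℤ.+ z) (Through.vec≡ r′ i)) (sym (ℤP.+-assoc (δ G e i) _ _))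
    ; length≡ = cong ℕ.suc (Through.length≡ r′)
    ; distinct-after = λ d → Through.distinct-after r′ (proj₂ d) }
    where r′ = through r x∈

  record Split {x y} (w : Walk x y) : Set where
    field
      {v}     : Fin nV
      A       : Walk x v
      B       : Walk v v
      C       : Walk v y
      B-nonempty : 0 ℕ.< ∣ B ∣
      C-nonempty : 0 ℕ.< ∣ C ∣
      vec≡    : ∀ i → vec w i ≡ (vec A +ᴱ (vec B +ᴱ vec C)) i
      length≡ : ∣ w ∣ ≡ ∣ A ∣ ℕ.+ (∣ B ∣ ℕ.+ ∣ C ∣)

  simple-or-split : ∀ {x y} (w : Walk x y) → Distinct (sources w) ⊎ Split w
  simple-or-split [] = inj₁ tt
  simple-or-split (step {u} e s t r) with simple-or-split r
  ... | inj₂ sp = inj₂ (record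
    { A = step e s t (Split.A sp) ; B = Split.B sp ; C = Split.C sp
    ; B-nonempty = Split.B-nonempty sp ; C-nonempty = Split.C-nonempty sp
    ; vec≡ = λ i → trans (cong (λ z → δ G e i ℤ.+ z) (Split.vec≡ sp i)) (sym (ℤP.+-assoc (δ G e i) _ _))
    ; length≡ = cong ℕ.suc (Split.length≡ sp) })
  ... | inj₁ distinct with any∈? (u ≟_) (sources r)
  ...   | no u∉ = inj₁ (u∉ , distinct)
  ...   | yes u∈ = inj₂ (record
    { A = [] ; B = step e s t (Through.before r′) ; C = Through.after r′
    ; B-nonempty = s≤s z≤n ; C-nonempty = Through.after-nonempty r′
    ; vec≡ = λ i → trans (trans (cong (λ z → δ G e i ℤ.+ z) (Through.vec≡ r′ i))
                                (sym (ℤP.+-assoc (δ G e i) _ _)))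
                         (sym (ℤP.+-identityˡ _))
    ; length≡ = cong ℕ.suc (Through.length≡ r′) })
    where r′ = through r u∈

  shortcut : ∀ {x y} (w : Walk x y) → Σ (Walk x y) λ w′ → Distinct (sources w′)
  shortcut [] = [] , tt
  shortcut (step {u} e s t r) with shortcut r
  ... | r′ , distinct with any∈? (u ≟_) (sources r′)
  ...   | no u∉ = step e s t r′ , (u∉ , distinct)
  ...   | yes u∈ = Through.after (through r′ u∈) , Through.distinct-after (through r′ u∈) distinct

  source∈ : ∀ {x y} (w : Walk x y) (i : Fin ∣ w ∣) → src (lookup (edges w) i) ∈ sources w
  source∈ (step e s t r) zero = here s
  source∈ (step e s t r) (suc i) = there (source∈ r i)

  simple-injective : ∀ {x y} (w : Walk x y) → Distinct (sources w) → ∀ i j →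
                     src (lookup (edges w) i) ≡ src (lookup (edges w) j) → i ≡ j
  simple-injective (step e s t r) _ zero zero _ = refl
  simple-injective (step e s t r) (u∉ , _) zero (suc j) eq =
    ⊥-elim (u∉ (subst (_∈ sources r) (trans (sym eq) s) (source∈ r j)))
  simple-injective (step e s t r) (u∉ , _) (suc i) zero eq =
    ⊥-elim (u∉ (subst (_∈ sources r) (trans eq s) (source∈ r i)))
  simple-injective (step e s t r) (_ , distinct) (suc i) (suc j) eq =
    cong suc (simple-injective r distinct i j eq)

  simple-length : ∀ {x y} (w : Walk x y) → Distinct (sources w) → ∣ w ∣ ℕ.≤ nV
  simple-length w distinct = injective⇒≤ (λ {i} {j} → simple-injective w distinct i j)

  chain-lookup : ∀ e {t y} (r : Walk t y) → tgt e ≡ t → ∀ (i : Fin ∣ r ∣) →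
                 tgt (lookup (e ∷ edges r) (Fin.inject₁ i)) ≡ src (lookup (edges r) i)
  chain-lookup e (step e′ s t r) et zero = trans et (sym s)
  chain-lookup e (step e′ s t r) et (suc i) = chain-lookup e′ r t i

  last-lookup : ∀ e {t y} (r : Walk t y) → tgt e ≡ t →
                tgt (lookup (e ∷ edges r) (Fin.fromℕ ∣ r ∣)) ≡ y
  last-lookup e [] et = et
  last-lookup e (step e′ s t r) et = last-lookup e′ r t

  sumFin-edges : ∀ {x y} (w : Walk x y) → ∀ i → sumFin G (λ j → δ G (lookup (edges w) j)) i ≡ vec w i
  sumFin-edges [] i = refl
  sumFin-edges (step e s t r) i = cong (λ z → δ G e i ℤ.+ z) (sumFin-edges r i)

  toCycle : ∀ {x} (w : Walk x x) → 0 ℕ.< ∣ w ∣ → Distinct (sources w) →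
            Σ (SimpleCycle G) λ C → ∀ i → ⟦_⟧ G C i ≡ vec w i
  toCycle w@(step e s t r) _ distinct =
    record { k = ∣ r ∣ ; cyc = lookup (edges w)
           ; chain = chain-lookup e r t
           ; close = trans (last-lookup e r t) (sym s)
           ; simple = λ {i} {j} → simple-injective w distinct i j }
    , sumFin-edges w

  walkAlong : ∀ k (f : Fin (ℕ.suc k) → Fin nE) →
              (∀ (i : Fin k) → tgt (f (Fin.inject₁ i)) ≡ src (f (suc i))) →
              ∀ {y} → tgt (f (Fin.fromℕ k)) ≡ y →
              Σ (Walk (src (f zero)) y) λ w → ∀ i → vec w i ≡ sumFin G (λ j → δ G (f j)) i
  walkAlong ℕ.zero f _ last = step (f zero) refl last [] , λ i → refl
  walkAlong (ℕ.suc k) f chain last with walkAlong k (λ i → f (suc i)) (λ i → chain (suc i)) last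
  ... | w , vec≡ = step (f zero) refl (chain zero) w , λ i → cong (λ z → δ G (f zero) i ℤ.+ z) (vec≡ i)

  fromCycle : (C : SimpleCycle G) → let x = src (SimpleCycle.cyc C zero) in
              Σ (Walk x x) λ w → ∀ i → vec w i ≡ ⟦_⟧ G C i
  fromCycle C = walkAlong k cyc chain close
    where open SimpleCycle C

  record Decomposition {x} (w : Walk x x) : Set where
    field
      {v}           : Fin nV
      loop          : Walk v v
      rest          : Walk x x
      loop-nonempty : 0 ℕ.< ∣ loop ∣
      rest-nonempty : 0 ℕ.< ∣ rest ∣
      loop-shorter  : ∣ loop ∣ ℕ.< ∣ w ∣
      rest-shorter  : ∣ rest ∣ ℕ.< ∣ w ∣
      vec≡          : ∀ i → vec w i ≡ (vec loop +ᴱ vec rest) i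

  decompose : ∀ {x} (w : Walk x x) → Split w → Decomposition w
  decompose w sp = record
    { loop = B ; rest = A ++ʷ C
    ; loop-nonempty = B-nonempty
    ; rest-nonempty = subst (0 ℕ.<_) (sym (∣∣-++ A C)) (ℕP.<-≤-trans C-nonempty (ℕP.m≤n+m ∣ C ∣ ∣ A ∣))
    ; loop-shorter = subst (∣ B ∣ ℕ.<_) (sym length≡)
                       (ℕP.<-≤-trans (ℕP.m<m+n ∣ B ∣ C-nonempty) (ℕP.m≤n+m _ ∣ A ∣))
    ; rest-shorter = subst₂ ℕ._<_ (sym (∣∣-++ A C)) (sym length≡)
                       (ℕP.+-monoʳ-< ∣ A ∣ (ℕP.m<n+m ∣ C ∣ B-nonempty))
    ; vec≡ = λ i → trans (vec≡ i) (trans (ℤ-swap (vec A i) (vec B i) (vec C i))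
                                        (cong (λ z → vec B i ℤ.+ z) (sym (vec-++ A C i))))
    }
    where
    open Split sp
    open import Algebra.Properties.CommutativeSemigroup ℤP.+-commutativeSemigroup
      using () renaming (x∙yz≈y∙xz to ℤ-swap)

  module _ where
    open ≡.≡-Reasoning
    open import Data.Integer.Tactic.RingSolver using (solve-∀)

    private
      rearrange : ∀ p d q t s → (p ℤ.+ (d ℤ.+ q)) ℤ.+ (t ℤ.+ s) ≡ (p ℤ.+ (d ℤ.+ s)) ℤ.+ (t ℤ.+ q)
      rearrange = solve-∀

    exchange-vec : ∀ {a s t b c y d} (P : Walk a s) e (se : src e ≡ s) (te : tgt e ≡ t)
                   (Q : Walk t b) (P′ : Walk c t) (r : Walk t y) (Q′ : Walk y d) →
                   ∀ i → (vec (P ++ʷ step e se te Q) +ᴱ vec (P′ ++ʷ r ++ʷ Q′)) i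
                       ≡ (vec (P ++ʷ step e se te (r ++ʷ Q′)) +ᴱ vec (P′ ++ʷ Q)) i
    exchange-vec P e se te Q P′ r Q′ i = begin
      vec (P ++ʷ step e se te Q) i ℤ.+ vec (P′ ++ʷ r ++ʷ Q′) i
        ≡⟨ cong₂ ℤ._+_ (vec-++ P _ i) (trans (vec-++ P′ _ i) (cong (λ z → vec P′ i ℤ.+ z) (vec-++ r Q′ i))) ⟩
      (vec P i ℤ.+ (δ G e i ℤ.+ vec Q i)) ℤ.+ (vec P′ i ℤ.+ (vec r i ℤ.+ vec Q′ i))
        ≡⟨ rearrange (vec P i) (δ G e i) (vec Q i) (vec P′ i) (vec r i ℤ.+ vec Q′ i) ⟩
      (vec P i ℤ.+ (δ G e i ℤ.+ (vec r i ℤ.+ vec Q′ i))) ℤ.+ (vec P′ i ℤ.+ vec Q i)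
        ≡⟨ cong₂ ℤ._+_ (trans (vec-++ P _ i) (cong (λ z → vec P i ℤ.+ (δ G e i ℤ.+ z)) (vec-++ r Q′ i)))
                       (vec-++ P′ Q i) ⟨
      vec (P ++ʷ step e se te (r ++ʷ Q′)) i ℤ.+ vec (P′ ++ʷ Q) i ∎

    conjugate-vec : ∀ {a x b} (P : Walk a x) (w : Walk x x) (Q : Walk x b) →
                    ∀ i → vec (P ++ʷ w ++ʷ Q) i ≡ (vec w +ᴱ vec (P ++ʷ Q)) i
    conjugate-vec P w Q i = begin
      vec (P ++ʷ w ++ʷ Q) i                      ≡⟨ trans (vec-++ P _ i) (cong (λ z → vec P i ℤ.+ z) (vec-++ w Q i)) ⟩
      vec P i ℤ.+ (vec w i ℤ.+ vec Q i)          ≡⟨ ℤ-swap (vec P i) (vec w i) (vec Q i) ⟩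
      vec w i ℤ.+ (vec P i ℤ.+ vec Q i)          ≡⟨ cong (λ z → vec w i ℤ.+ z) (vec-++ P Q i) ⟨
      vec w i ℤ.+ vec (P ++ʷ Q) i                ∎
      where
      open import Algebra.Properties.CommutativeSemigroup ℤP.+-commutativeSemigroup
        using () renaming (x∙yz≈y∙xz to ℤ-swap)

-- Reachability is decidable because a
-- walk can be shortened to at most nV edges; this lets every component choose
-- a root, the first vertex (in the order of Fin nV) linked to it both ways.
module Components (G : Digraph) where
  open Digraph G
  open Walks G
  open ≡ using (refl; sym; trans; cong; subst)
  open import Data.Bool using (Bool; true; false; T; if_then_else_)
  open import Data.Maybe using (Maybe; just; nothing; fromMaybe)
  import Data.Maybe as Maybe
  open import Relation.Nullary using (Dec; map′; _×-dec_)
  open import Relation.Nullary.Decidable using (isYes; isYes≗does; toWitness; fromWitness; does-⇔)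
  open import Function.Bundles using (mk⇔)

  ShortWalk : ℕ → Fin nV → Fin nV → Set
  ShortWalk k u v = Σ (Walk u v) λ w → ∣ w ∣ ℕ.≤ k

  FirstStep : ℕ → Fin nV → Fin nV → Set
  FirstStep k u v = ∃ λ e → src e ≡ u × ShortWalk k (tgt e) v

  firstStep : ∀ {k u v} → u ≢ v → ShortWalk (ℕ.suc k) u v → FirstStep k u v
  firstStep u≢v ([] , _) = ⊥-elim (u≢v refl)
  firstStep _ (step e s refl w , s≤s ∣w∣≤k) = e , s , w , ∣w∣≤k

  no-short-walk : ∀ {u v} → u ≢ v → ¬ ShortWalk 0 u v
  no-short-walk u≢v ([] , _) = u≢v refl

  shortWalk? : ∀ k u v → Dec (ShortWalk k u v)
  shortWalk? k u v with u ≟ v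
  shortWalk? k u .u | yes refl = yes ([] , z≤n)
  shortWalk? ℕ.zero u v | no u≢v = no (no-short-walk u≢v)
  shortWalk? (ℕ.suc k) u v | no u≢v =
    map′ (λ { (e , s , w , ∣w∣≤k) → step e s refl w , s≤s ∣w∣≤k }) (firstStep u≢v)
         (any? λ e → (src e ≟ u) ×-dec shortWalk? k (tgt e) v)

  reachable? : ∀ u v → Dec (Walk u v)
  reachable? u v = map′ proj₁ shorten (shortWalk? nV u v)
    where
    shorten : Walk u v → ShortWalk nV u v
    shorten w = proj₁ (shortcut w) , simple-length _ (proj₂ (shortcut w))

  Linked : Fin nV → Fin nV → Set
  Linked u v = Walk u v × Walk v u

  linked? : ∀ u v → Dec (Linked u v)
  linked? u v = reachable? u v ×-dec reachable? v u

  first : ∀ {n} → (Fin n → Bool) → Maybe (Fin n)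
  first {ℕ.zero} f = nothing
  first {ℕ.suc n} f = if f zero then just zero else Maybe.map suc (first (λ i → f (suc i)))

  first-sound : ∀ {n} (f : Fin n → Bool) {j} → first f ≡ just j → T (f j)
  first-sound {ℕ.suc n} f eq with f zero in f₀
  first-sound {ℕ.suc n} f refl | true = subst T (sym f₀) tt
  ... | false with first (λ i → f (suc i)) in eq′
  first-sound {ℕ.suc n} f refl | false | just j = first-sound (λ i → f (suc i)) eq′

  first-complete : ∀ {n} (f : Fin n → Bool) (i : Fin n) → T (f i) → ∃ λ j → first f ≡ just j
  first-complete {ℕ.suc n} f zero p with f zero
  ... | true = zero , refl
  first-complete {ℕ.suc n} f (suc i) p with f zero
  ... | true = zero , refl
  ... | false with first-complete (λ j → f (suc j)) i p
  ...   | j , eq = suc j , cong (Maybe.map suc) eq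

  first-cong : ∀ {n} (f g : Fin n → Bool) → (∀ i → f i ≡ g i) → first f ≡ first g
  first-cong {ℕ.zero} f g eq = refl
  first-cong {ℕ.suc n} f g eq
    rewrite eq zero | first-cong (λ i → f (suc i)) (λ i → g (suc i)) (λ i → eq (suc i)) = refl

  root : Fin nV → Fin nV
  root u = fromMaybe u (first (λ x → isYes (linked? x u)))

  root-linked : ∀ u → Linked (root u) u
  root-linked u with first-complete (λ x → isYes (linked? x u)) u (fromWitness ([] , []))
  ... | j , eq = subst (λ m → Linked (fromMaybe u m) u) (sym eq) (toWitness (first-sound _ eq))

  root-cong : ∀ {u v} → Linked u v → root u ≡ root v
  root-cong {u} {v} (u→v , v→u)
    with first-complete (λ x → isYes (linked? x u)) u (fromWitness ([] , []))
  ... | j , eq = trans (cong (fromMaybe u) eq)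
                       (cong (fromMaybe v) (sym (trans (sym (first-cong _ _ same-test)) eq)))
    where
    via : ∀ {a b x} → Walk a b → Walk b a → Linked x a → Linked x b
    via a→b b→a (x→a , a→x) = x→a ++ʷ a→b , b→a ++ʷ a→x

    same-test : ∀ x → isYes (linked? x u) ≡ isYes (linked? x v)
    same-test x = trans (isYes≗does (linked? x u))
                    (trans (does-⇔ (mk⇔ (via u→v v→u) (via v→u u→v)) (linked? x u) (linked? x v))
                           (sym (isYes≗does (linked? x v))))

  Internal : ∀ {x y} → Walk x y → Set
  Internal [] = ⊤
  Internal (step {u} {t} e _ _ r) = root u ≡ root t × Internal r

  internal-root : ∀ {x y} (w : Walk x y) → Internal w → root x ≡ root y
  internal-root [] _ = refl
  internal-root (step e s t r) (same , internal) = trans same (internal-root r internal)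

  returning-internal : ∀ {x y} (w : Walk x y) → Walk y x → Internal w
  returning-internal [] _ = tt
  returning-internal (step e s t r) back =
    root-cong (step e s t [] , r ++ʷ back) , returning-internal r (back ++ʷ step e s t [])

module AdditiveMaps {c ℓ} (R : RealField c ℓ) (G : Digraph) where
  open RealField R hiding (zero; _<_; _≤_)
  open OrderedField R
  open Digraph G
  open ≡ using (cong; cong₂)
  open import Algebra.Properties.Ring ring using (x+x≈x⇒x≈0; +-inverseʳ-unique; -‿+-comm)
  open import Algebra.Properties.CommutativeSemigroup +-commutativeSemigroup
    using () renaming (interchange to +-interchange)
  open import Algebra.Properties.Semiring.Sum semiring using (sum; sum-cong-≋; ∑-distrib-+)
  open import Relation.Binary.Reasoning.Setoid setoid

  restrict : Additive G R → AdditiveOnM G R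
  restrict b = record
    { fun = λ x _ → fun x ; wd = λ _ _ → wd ; additive = λ {x} {y} _ _ _ → additive x y }
    where open Additive b

  module _ (a : AdditiveOnM G R) where
    open AdditiveOnM a

    onM-zero : ∀ {x} (p : InM G x) → (∀ i → x i ≡ + 0) → fun x p ≈ 0#
    onM-zero {x} p x≐0 = x+x≈x⇒x≈0 (fun x p) (begin
      fun x p + fun x p       ≈⟨ additive p p (add p p) ⟨
      fun (_⊕_ G x x) (add p p) ≈⟨ wd (add p p) p (λ i → ≡.trans (cong₂ ℤ._+_ (x≐0 i) (x≐0 i)) (≡.sym (x≐0 i))) ⟩
      fun x p                 ∎)

    onM-neg : ∀ {x} (p : InM G x) → fun (⊖_ G x) (neg p) ≈ - fun x p
    onM-neg {x} p = +-inverseʳ-unique (fun x p) _ (begin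
      fun x p + fun (⊖_ G x) (neg p)          ≈⟨ additive p (neg p) (add p (neg p)) ⟨
      fun (_⊕_ G x (⊖_ G x)) (add p (neg p))  ≈⟨ onM-zero (add p (neg p)) (λ i → ℤP.+-inverseʳ (x i)) ⟩
      0#                                      ∎)

  agree-on-M : (a b : AdditiveOnM G R) →
               (∀ C → AdditiveOnM.fun a (⟦_⟧ G C) (gen C) ≈ AdditiveOnM.fun b (⟦_⟧ G C) (gen C)) →
               ∀ {x} (p : InM G x) → AdditiveOnM.fun a x p ≈ AdditiveOnM.fun b x p
  agree-on-M a b on-cycles = go
    where
    module a = AdditiveOnM a
    module b = AdditiveOnM b

    go : ∀ {x} (p : InM G x) → a.fun x p ≈ b.fun x p
    go (gen C) = on-cycles C
    go zer = trans (onM-zero a zer (λ _ → ≡.refl)) (sym (onM-zero b zer (λ _ → ≡.refl)))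
    go (add {x} {y} p q) = begin
      a.fun (_⊕_ G x y) (add p q) ≈⟨ a.additive p q (add p q) ⟩
      a.fun x p + a.fun y q       ≈⟨ +-cong (go p) (go q) ⟩
      b.fun x p + b.fun y q       ≈⟨ b.additive p q (add p q) ⟨
      b.fun (_⊕_ G x y) (add p q) ∎
    go (neg {x} p) = begin
      a.fun (⊖_ G x) (neg p) ≈⟨ onM-neg a p ⟩
      - a.fun x p            ≈⟨ -‿cong (go p) ⟩
      - b.fun x p            ≈⟨ onM-neg b p ⟨
      b.fun (⊖_ G x) (neg p) ∎
    go (resp {x} {y} x≐y p) = begin
      a.fun y (resp x≐y p) ≈⟨ a.wd (resp x≐y p) p (λ i → ≡.sym (x≐y i)) ⟩
      a.fun x p            ≈⟨ go p ⟩
      b.fun x p            ≈⟨ b.wd p (resp x≐y p) x≐y ⟩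
      b.fun y (resp x≐y p) ∎

  additive-sumFin : (b : Additive G R) → ∀ {m} (f : Fin m → ZE G) →
                    Additive.fun b (sumFin G f) ≈ sum (λ i → Additive.fun b (f i))
  additive-sumFin b {ℕ.zero} f = onM-zero (restrict b) zer (λ _ → ≡.refl)
  additive-sumFin b {ℕ.suc m} f =
    trans (Additive.additive b (f zero) _) (+-congˡ (additive-sumFin b (λ i → f (suc i))))

  δ-diag : ∀ e → δ G e e ≡ + 1
  δ-diag e with e ≟ e
  ... | yes _ = ≡.refl
  ... | no e≢e = ⊥-elim (e≢e ≡.refl)

  δ-off : ∀ {e i} → e ≢ i → δ G e i ≡ + 0
  δ-off {e} {i} e≢i with e ≟ i
  ... | yes e≡i = ⊥-elim (e≢i e≡i)
  ... | no _ = ≡.refl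

  linear : (Fin nE → Carrier) → Additive G R
  linear g = record
    { fun = L
    ; wd = λ x≐y → sum-cong-≋ (λ e → *-congʳ (reflexive (cong fromℤ (x≐y e))))
    ; additive = λ x y → trans (sum-cong-≋ (λ e → split (x e) (y e) (g e)))
                               (∑-distrib-+ {nE} (λ e → fromℤ (x e) * g e) (λ e → fromℤ (y e) * g e))
    }
    where
    L : ZE G → Carrier
    L x = sum (λ e → fromℤ (x e) * g e)

    split : ∀ m n w → fromℤ (m ℤ.+ n) * w ≈ fromℤ m * w + fromℤ n * w
    split m n w = trans (*-congʳ (fromℤ-+ m n)) (distribʳ w (fromℤ m) (fromℤ n))

  linear-δ : ∀ g e → Additive.fun (linear g) (δ G e) ≈ g e
  linear-δ g e = begin
    sum (λ i → fromℤ (δ G e i) * g i) ≈⟨ sum-single _ e off-diagonal ⟩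
    fromℤ (δ G e e) * g e             ≈⟨ *-congʳ (reflexive (cong fromℤ (δ-diag e))) ⟩
    (1# + 0#) * g e                   ≈⟨ *-congʳ (+-identityʳ 1#) ⟩
    1# * g e                          ≈⟨ *-identityˡ (g e) ⟩
    g e                               ∎
    where
    off-diagonal : ∀ i → e ≢ i → fromℤ (δ G e i) * g i ≈ 0#
    off-diagonal i e≢i = trans (*-congʳ (reflexive (cong fromℤ (δ-off e≢i)))) (zeroˡ (g i))

  count : Additive G R
  count = linear (λ _ → 1#)

  count-cycle : ∀ C → Additive.fun count (⟦_⟧ G C) ≈ fromℕ (len G C)
  count-cycle C = begin
    Additive.fun count (⟦_⟧ G C)                 ≈⟨ additive-sumFin count (λ i → δ G (cyc i)) ⟩
    sum (λ i → Additive.fun count (δ G (cyc i)))  ≈⟨ sum-cong-≋ (λ i → linear-δ (λ _ → 1#) (cyc i)) ⟩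
    sum {ℕ.suc k} (λ _ → 1#)                      ≈⟨ sum-ones (ℕ.suc k) ⟩
    fromℕ (len G C)                                     ∎
    where open SimpleCycle C

  _+ᴹ_ : AdditiveOnM G R → Additive G R → AdditiveOnM G R
  a +ᴹ b = record
    { fun = λ x p → A.fun x p + B.fun x
    ; wd = λ p q x≐y → +-cong (A.wd p q x≐y) (B.wd x≐y)
    ; additive = λ {x} {y} p q r → trans (+-cong (A.additive p q r) (B.additive x y))
                                        (+-interchange _ _ _ _)
    }
    where
    module A = AdditiveOnM a
    module B = Additive b

  _−ᴬ_ : Additive G R → Additive G R → Additive G R
  a −ᴬ b = record
    { fun = λ x → A.fun x + - B.fun x
    ; wd = λ x≐y → +-cong (A.wd x≐y) (-‿cong (B.wd x≐y))
    ; additive = λ x y → begin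
        A.fun (_⊕_ G x y) + - B.fun (_⊕_ G x y)           ≈⟨ +-cong (A.additive x y) (-‿cong (B.additive x y)) ⟩
        (A.fun x + A.fun y) + - (B.fun x + B.fun y)       ≈⟨ +-congˡ (-‿+-comm _ _) ⟨
        (A.fun x + A.fun y) + (- B.fun x + - B.fun y)     ≈⟨ +-interchange _ _ _ _ ⟩
        (A.fun x + - B.fun x) + (A.fun y + - B.fun y)     ∎
    }
    where
    module A = Additive a
    module B = Additive b

module PositiveExtension {c ℓ} (R : RealField c ℓ) (G : Digraph) (a : AdditiveOnM G R)
  (positive : ∀ C → RealField._<_ R (RealField.0# R) (AdditiveOnM.fun a (⟦_⟧ G C) (gen C)))
  where
  open RealField R hiding (zero; _<_; _≤_)
  open OrderedField R
  open Digraph G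
  open Walks G
  open Components G
  open AdditiveMaps R G
  open AdditiveOnM a
  open Potentials R using (Edge; PositiveCycles; potential)
    renaming (Walk to WeightedWalk; weight to weightᵂ)
  open import Algebra.Properties.Ring ring using (//-rightDividesʳ; \\-leftDividesˡ; +-cancelʳ)
  open import Algebra.Properties.CommutativeSemigroup +-commutativeSemigroup
    using (xy∙z≈xz∙y) renaming (interchange to +-interchange)
  open import Data.List using (map; allFin)
  open import Data.List.Membership.Propositional.Properties using (∈-map⁺; ∈-map⁻; ∈-allFin)
  open import Relation.Binary.Reasoning.Setoid setoid

  -- Every closed walk w has vec w ∈ M, and a(vec w) > 0 if w is nonempty:
  -- split w into simple cycles, by recursion on its length.
  closed-walk : ∀ fuel {x y} (w : Walk x y) → x ≡ y → ∣ w ∣ ℕ.≤ fuel →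
                Σ (InM G (vec w)) λ m → 0 ℕ.< ∣ w ∣ → 0# < fun (vec w) m
  closed-walk _ [] _ _ = zer , λ ()
  closed-walk ℕ.zero (step _ _ _ _) _ ()
  closed-walk (ℕ.suc fuel) w@(step _ _ _ _) ≡.refl ∣w∣≤ with simple-or-split w
  ... | inj₁ distinct with toCycle w (s≤s z≤n) distinct
  ...   | C , C≡w = resp C≡w (gen C) , λ _ → <-respʳ-≈ (wd (gen C) (resp C≡w (gen C)) C≡w) (positive C)
  closed-walk (ℕ.suc fuel) w@(step _ _ _ _) ≡.refl ∣w∣≤ | inj₂ sp =
    w∈M , λ _ → <-respʳ-≈ sum≈ (+-pos (proj₂ loop-facts loop-nonempty) (proj₂ rest-facts rest-nonempty))
    where
    open Decomposition (decompose w sp)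
    fits : ∀ {k} → k ℕ.< ∣ w ∣ → k ℕ.≤ fuel
    fits k< = ℕ.s≤s⁻¹ (ℕP.≤-trans k< ∣w∣≤)
    loop-facts : Σ (InM G (vec loop)) λ m → 0 ℕ.< ∣ loop ∣ → 0# < fun (vec loop) m
    loop-facts = closed-walk fuel loop ≡.refl (fits loop-shorter)
    rest-facts : Σ (InM G (vec rest)) λ m → 0 ℕ.< ∣ rest ∣ → 0# < fun (vec rest) m
    rest-facts = closed-walk fuel rest ≡.refl (fits rest-shorter)
    both : InM G (vec loop +ᴱ vec rest)
    both = add (proj₁ loop-facts) (proj₁ rest-facts)
    w∈M : InM G (vec w)
    w∈M = resp (λ i → ≡.sym (vec≡ i)) both
    sum≈ : fun (vec loop) (proj₁ loop-facts) + fun (vec rest) (proj₁ rest-facts) ≈ fun (vec w) w∈M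
    sum≈ = trans (sym (additive _ _ both)) (wd both w∈M (λ i → ≡.sym (vec≡ i)))

  inM : ∀ {x y} (w : Walk x y) → x ≡ y → InM G (vec w)
  inM w x≡y = proj₁ (closed-walk ∣ w ∣ w x≡y ℕP.≤-refl)

  value : ∀ {x y} (w : Walk x y) → x ≡ y → Carrier
  value w x≡y = fun (vec w) (inM w x≡y)

  value-pos : ∀ {x y} (w : Walk x y) (x≡y : x ≡ y) → 0 ℕ.< ∣ w ∣ → 0# < value w x≡y
  value-pos w x≡y = proj₂ (closed-walk ∣ w ∣ w x≡y ℕP.≤-refl)

  value-irrelevant : ∀ {x y} (w : Walk x y) (p q : x ≡ y) → value w p ≈ value w q
  value-irrelevant w p q = wd (inM w p) (inM w q) (λ _ → ≡.refl)

  value-+ : ∀ {x₁ y₁ x₂ y₂} (w₁ : Walk x₁ y₁) (e₁ : x₁ ≡ y₁) (w₂ : Walk x₂ y₂) (e₂ : x₂ ≡ y₂) →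
            value w₁ e₁ + value w₂ e₂ ≈ fun (vec w₁ +ᴱ vec w₂) (add (inM w₁ e₁) (inM w₂ e₂))
  value-+ w₁ e₁ w₂ e₂ = sym (additive _ _ _)

  value-exchange : ∀ {x₁ y₁ x₂ y₂ x₃ y₃ x₄ y₄}
                   (w₁ : Walk x₁ y₁) e₁ (w₂ : Walk x₂ y₂) e₂ (w₃ : Walk x₃ y₃) e₃ (w₄ : Walk x₄ y₄) e₄ →
                   (∀ i → (vec w₁ +ᴱ vec w₂) i ≡ (vec w₃ +ᴱ vec w₄) i) →
                   value w₁ e₁ + value w₂ e₂ ≈ value w₃ e₃ + value w₄ e₄
  value-exchange w₁ e₁ w₂ e₂ w₃ e₃ w₄ e₄ same =
    trans (value-+ w₁ e₁ w₂ e₂) (trans (wd _ _ same) (sym (value-+ w₃ e₃ w₄ e₄)))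

  -- Initial weights: route each edge e inside a component through the root,
  -- h₀(e) = a(root → src e → tgt e → root) - a(root → tgt e → root).
  fromRoot : ∀ u → Walk (root u) u
  fromRoot u = proj₁ (root-linked u)

  toRoot : ∀ u → Walk u (root u)
  toRoot u = proj₂ (root-linked u)

  loopAt : ∀ v → Walk (root v) (root v)
  loopAt v = fromRoot v ++ʷ toRoot v

  detour : ∀ e → Walk (root (src e)) (root (tgt e))
  detour e = fromRoot (src e) ++ʷ step e ≡.refl ≡.refl (toRoot (tgt e))

  h₀ : Fin nE → Carrier
  h₀ e with root (src e) ≟ root (tgt e)
  ... | yes same = value (detour e) same + - value (loopAt (tgt e)) ≡.refl
  ... | no _ = 0#

  h₀-internal : ∀ e (same : root (src e) ≡ root (tgt e)) →
                h₀ e ≈ value (detour e) same + - value (loopAt (tgt e)) ≡.refl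
  h₀-internal e same with root (src e) ≟ root (tgt e)
  ... | yes same′ = +-congʳ (value-irrelevant (detour e) same′ same)
  ... | no differ = ⊥-elim (differ same)

  total : (Fin nE → Carrier) → ∀ {x y} → Walk x y → Carrier
  total f [] = 0#
  total f (step e _ _ r) = f e + total f r

  cancel-middle : ∀ {X Y Z B D} → X + Y ≈ Z + B → (X + - B) + (Y + - D) ≈ Z + - D
  cancel-middle {X} {Y} {Z} {B} {D} X+Y≈Z+B = begin
    (X + - B) + (Y + - D) ≈⟨ +-interchange X (- B) Y (- D) ⟩
    (X + Y) + (- B + - D) ≈⟨ +-congʳ X+Y≈Z+B ⟩
    (Z + B) + (- B + - D) ≈⟨ +-assoc Z B _ ⟩
    Z + (B + (- B + - D)) ≈⟨ +-congˡ (\\-leftDividesˡ B (- D)) ⟩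
    Z + - D               ∎

  -- Along an internal walk w : x → y the weights h₀ telescope:
  -- Σ_w h₀ = a(root → x → y → root) - a(loop at y).
  total-h₀ : ∀ {x y} (w : Walk x y) (internal : Internal w) →
             total h₀ w ≈ value (fromRoot x ++ʷ w ++ʷ toRoot y) (internal-root w internal)
                          + - value (loopAt y) ≡.refl
  total-h₀ [] _ = sym (-‿inverseʳ _)
  total-h₀ {y = y} (step e ≡.refl ≡.refl r) (same , internal) = begin
    h₀ e + total h₀ r
      ≈⟨ +-cong (h₀-internal e same) (total-h₀ r internal) ⟩
    (value (detour e) same + - value (loopAt (tgt e)) ≡.refl)
      + (value onward (internal-root r internal) + - value (loopAt y) ≡.refl)
      ≈⟨ cancel-middle (value-exchange (detour e) same onward _ rerouted _ (loopAt (tgt e)) ≡.refl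
                          (exchange-vec (fromRoot (src e)) e ≡.refl ≡.refl (toRoot (tgt e))
                                        (fromRoot (tgt e)) r (toRoot y))) ⟩
    value rerouted (≡.trans same (internal-root r internal)) + - value (loopAt y) ≡.refl ∎
    where
    onward : Walk (root (tgt e)) (root y)
    onward = fromRoot (tgt e) ++ʷ r ++ʷ toRoot y
    rerouted : Walk (root (src e)) (root y)
    rerouted = fromRoot (src e) ++ʷ step e ≡.refl ≡.refl (r ++ʷ toRoot y)

  total-h₀-closed : ∀ {x} (w : Walk x x) → total h₀ w ≈ value w ≡.refl
  total-h₀-closed {x} w = begin
    total h₀ w                                                ≈⟨ total-h₀ w internal ⟩
    value conjugate _ + - value (loopAt x) ≡.refl             ≈⟨ +-congʳ split ⟩
    (value w ≡.refl + value (loopAt x) ≡.refl) + - value (loopAt x) ≡.refl ≈⟨ //-rightDividesʳ _ _ ⟩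
    value w ≡.refl                                            ∎
    where
    internal : Internal w
    internal = returning-internal w []
    conjugate : Walk (root x) (root x)
    conjugate = fromRoot x ++ʷ w ++ʷ toRoot x
    split : value conjugate (internal-root w internal) ≈ value w ≡.refl + value (loopAt x) ≡.refl
    split = trans (wd _ _ (conjugate-vec (fromRoot x) w (toRoot x)))
                  (sym (value-+ w ≡.refl (loopAt x) ≡.refl))

  -- Positivity: shift h₀ by a Fourier–Motzkin potential.  Every cycle of the
  -- graph weighted by h₀ is a closed walk of G, whose value is positive.
  weighted : List (Edge nV)
  weighted = map (λ e → src e , tgt e , h₀ e) (allFin nE)

  unweighted : ∀ {u v} (r : WeightedWalk weighted u v) → Σ (Walk u v) λ w → total h₀ w ≈ weightᵂ r
  unweighted Potentials.[] = [] , refl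
  unweighted (Potentials.step m r) with ∈-map⁻ (λ e → src e , tgt e , h₀ e) m
  ... | e , _ , ≡.refl with unweighted r
  ...   | w , w≈r = step e ≡.refl ≡.refl w , +-congˡ w≈r

  weighted-positive : PositiveCycles weighted
  weighted-positive m r with ∈-map⁻ (λ e → src e , tgt e , h₀ e) m
  ... | e , _ , ≡.refl with unweighted r
  ...   | w , w≈r = <-respʳ-≈ (trans (sym (total-h₀-closed cycle)) (+-congˡ w≈r))
                              (value-pos cycle ≡.refl (s≤s z≤n))
    where
    cycle : Walk (src e) (src e)
    cycle = step e ≡.refl ≡.refl w

  p : Fin nV → Carrier
  p = proj₁ (potential nV weighted weighted-positive)

  h : Fin nE → Carrier
  h e = (h₀ e + p (src e)) + - p (tgt e)

  h-pos : ∀ e → 0# < h e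
  h-pos e = proj₂ (potential nV weighted weighted-positive)
                  (∈-map⁺ (λ e → src e , tgt e , h₀ e) (∈-allFin e))

  -- the potential telescopes along walks, so closed walks keep their weight
  total-h : ∀ {x y} (w : Walk x y) → total h w + p y ≈ total h₀ w + p x
  total-h [] = refl
  total-h {y = y} (step e ≡.refl ≡.refl r) = begin
    (h e + total h r) + p y                                 ≈⟨ +-assoc _ _ _ ⟩
    h e + (total h r + p y)                                 ≈⟨ +-congˡ (total-h r) ⟩
    ((h₀ e + p (src e)) + - p (tgt e)) + (total h₀ r + p (tgt e)) ≈⟨ +-interchange _ _ _ _ ⟩
    ((h₀ e + p (src e)) + total h₀ r) + (- p (tgt e) + p (tgt e)) ≈⟨ +-congˡ (-‿inverseˡ _) ⟩
    ((h₀ e + p (src e)) + total h₀ r) + 0#                  ≈⟨ +-identityʳ _ ⟩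
    (h₀ e + p (src e)) + total h₀ r                         ≈⟨ xy∙z≈xz∙y _ _ _ ⟩
    (h₀ e + total h₀ r) + p (src e)                         ∎

  total-h-closed : ∀ {x} (w : Walk x x) → total h w ≈ total h₀ w
  total-h-closed {x} w = +-cancelʳ (p x) _ _ (total-h w)

  extension : Additive G R
  extension = linear h

  open Additive extension using () renaming (fun to ext)

  extension-walk : ∀ {x y} (w : Walk x y) → ext (vec w) ≈ total h w
  extension-walk [] = onM-zero (restrict extension) zer (λ _ → ≡.refl)
  extension-walk (step e _ _ r) =
    trans (Additive.additive extension (δ G e) (vec r)) (+-cong (linear-δ h e) (extension-walk r))

  extension-cycle : ∀ C → ext (⟦_⟧ G C) ≈ fun (⟦_⟧ G C) (gen C)
  extension-cycle C with fromCycle C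
  ... | W , W≡C = begin
    ext (⟦_⟧ G C)        ≈⟨ Additive.wd extension (λ i → ≡.sym (W≡C i)) ⟩
    ext (vec W)          ≈⟨ extension-walk W ⟩
    total h W            ≈⟨ total-h-closed W ⟩
    total h₀ W           ≈⟨ total-h₀-closed W ⟩
    value W ≡.refl       ≈⟨ wd _ (gen C) W≡C ⟩
    fun (⟦_⟧ G C) (gen C) ∎

  positive-extension : Σ (Additive G R) λ b →
                         (∀ x (m : InM G x) → Additive.fun b x ≈ fun x m)
                       × (∀ e → 0# < Additive.fun b (δ G e))
  positive-extension =
    extension ,
    (λ x m → agree-on-M (restrict extension) a extension-cycle m) ,
    (λ e → <-respʳ-≈ (sym (linear-δ h e)) (h-pos e))

lemma4p6 : ∀ {c ℓ : Level} (R : RealField c ℓ) (G : Digraph) →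
    (cM : AdditiveOnM G R) →
    (∀ (C : SimpleCycle G) →
      RealField._<_ R (RealField.-_ R (RealField.fromℕ R (len G C)))
        (AdditiveOnM.fun cM (⟦_⟧ G C) (gen C))) →
    Σ (Additive G R) λ c′ →
      (∀ (x : ZE G) (p : InM G x) →
        RealField._≈_ R (Additive.fun c′ x) (AdditiveOnM.fun cM x p))
      × (∀ (e : Fin (Digraph.nE G)) →
        RealField._<_ R (RealField.-_ R (RealField.1# R)) (Additive.fun c′ (δ G e)))
lemma4p6 R G cM above-−len = b −ᴬ count , agrees , above-−1
  where
  open RealField R hiding (zero; _<_; _≤_)
  open OrderedField R
  open AdditiveMaps R G
  open import Algebra.Properties.Ring ring using (-‿involutive; //-rightDividesʳ)

  N : ZE G → Carrier
  N = Additive.fun count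

  -- a = c + N is positive on every simple cycle, because N(C) = |C|
  a-positive : ∀ C → 0# < AdditiveOnM.fun (cM +ᴹ count) (⟦_⟧ G C) (gen C)
  a-positive C = <-respʳ-≈ (+-congˡ (trans (-‿involutive _) (sym (count-cycle C))))
                           (<⇒0<-diff (above-−len C))

  open PositiveExtension R G (cM +ᴹ count) a-positive using (positive-extension)
  b : Additive G R
  b = proj₁ positive-extension

  agrees : ∀ x p → Additive.fun b x + - N x ≈ AdditiveOnM.fun cM x p
  agrees x p = trans (+-congʳ (proj₁ (proj₂ positive-extension) x p))
                     (//-rightDividesʳ (N x) (AdditiveOnM.fun cM x p))

  above-−1 : ∀ e → - 1# < Additive.fun b (δ G e) + - N (δ G e)
  above-−1 e = <-respˡ-≈ (trans (+-identityˡ _) (-‿cong (linear-δ _ e)))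
                         (+-monoˡ-< (- N (δ G e)) (proj₂ (proj₂ positive-extension) e))
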